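{- Let $G$ be an abelian group and $S\subset G$. Let $\Gamma(G,S)$ be the Cayley sum graph. (1) If $S$ is a Sidon set in $G$, then $\Gamma(G,S)$ contains no $4$-cycle $C_4$. (2) If $S$ is a partial symmetric Sidon set in $G$, then $\Gamma(G,S)$ contains no copy of $K_{2,3}$.
   Context: The Cayley sum graph $\Gamma(G,S)$ has vertex set $G$, with $x$ and $y$ joined by an edge iff $x+y\in S$. $S$ is a Sidon set if every solution of $\alpha+\beta=\gamma+\delta$ with $(\alpha,\beta,\gamma,\delta)\in S^4$ has $\alpha\in\{\gamma,\delta\}$. $S$ is a partial symmetric Sidon set with center $a_0\in S$ if every solution $(\alpha,\beta,\gamma,\delta)\in S^4$ of $\alpha+\beta=\gamma+\delta$ satisfies either $\alpha\in\{\gamma,\delta\}$ or $\alpha+\beta=\gamma+\delta=a_0$. -}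

module Defs where

open import Level using (Level; _⊔_)
open import Algebra.Bundles using (AbelianGroup)
open import Relation.Unary using (Pred; _∈_)
open import Relation.Nullary using (¬_)
open import Data.Product using (_×_; ∃-syntax)
open import Data.Sum using (_⊎_)

module _ {c ℓ p : Level} (G : AbelianGroup c ℓ) where
  open AbelianGroup G renaming (Carrier to A)

  RespectsEq : Pred A p → Set _
  RespectsEq S = ∀ {x y} → x ≈ y → x ∈ S → y ∈ S

  Adj : Pred A p → A → A → Set p
  Adj S x y = (x ∙ y) ∈ S

  IsSidon : Pred A p → Set _
  IsSidon S = ∀ {α β γ δ} → α ∈ S → β ∈ S → γ ∈ S → δ ∈ S →
              (α ∙ β) ≈ (γ ∙ δ) → (α ≈ γ) ⊎ (α ≈ δ)

  IsPartialSymSidon : Pred A p → A → Set _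
  IsPartialSymSidon S a₀ = a₀ ∈ S ×
    (∀ {α β γ δ} → α ∈ S → β ∈ S → γ ∈ S → δ ∈ S →
       (α ∙ β) ≈ (γ ∙ δ) →
       ((α ≈ γ) ⊎ (α ≈ δ)) ⊎ (((α ∙ β) ≈ a₀) × ((γ ∙ δ) ≈ a₀)))

  -- Γ(G,S) contains a 4-cycle x₁x₂x₃x₄ (distinct vertices; not necessarily induced)
  HasC4 : Pred A p → Set _
  HasC4 S = ∃[ x₁ ] ∃[ x₂ ] ∃[ x₃ ] ∃[ x₄ ]
    ((¬ x₁ ≈ x₂) × (¬ x₁ ≈ x₃) × (¬ x₁ ≈ x₄) × (¬ x₂ ≈ x₃) × (¬ x₂ ≈ x₄) × (¬ x₃ ≈ x₄))
    × (Adj S x₁ x₂ × Adj S x₂ x₃ × Adj S x₃ x₄ × Adj S x₄ x₁)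

  -- Γ(G,S) contains a copy of K_{2,3} (5 distinct vertices a₁,a₂ | b₁,b₂,b₃; not necessarily induced)
  HasK23 : Pred A p → Set _
  HasK23 S = ∃[ a₁ ] ∃[ a₂ ] ∃[ b₁ ] ∃[ b₂ ] ∃[ b₃ ]
    ((¬ a₁ ≈ a₂) × (¬ a₁ ≈ b₁) × (¬ a₁ ≈ b₂) × (¬ a₁ ≈ b₃)
     × (¬ a₂ ≈ b₁) × (¬ a₂ ≈ b₂) × (¬ a₂ ≈ b₃)
     × (¬ b₁ ≈ b₂) × (¬ b₁ ≈ b₃) × (¬ b₂ ≈ b₃))
    × (Adj S a₁ b₁ × Adj S a₁ b₂ × Adj S a₁ b₃
       × Adj S a₂ b₁ × Adj S a₂ b₂ × Adj S a₂ b₃)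

{-# OPTIONS --safe #-}
module Submission where

-- The four vertices of a 4-cycle x₁x₂x₃x₄ satisfy
-- (x₁ + x₂) + (x₃ + x₄) = (x₁ + x₄) + (x₃ + x₂), a relation between edge labels in S
-- which is non-trivial exactly because opposite vertices are distinct.
-- For K₂,₃ the partial Sidon property forces each of the 4-cycles a₁b₁a₂b₂ and
-- a₁b₁a₂b₃ to have sum a₀; these share the edge a₁b₁, so cancelling gives b₂ = b₃.

open import Defs
open import Level using (Level)
open import Algebra.Bundles using (AbelianGroup)
open import Relation.Unary using (Pred)
open import Relation.Nullary using (¬_; contradiction)
open import Data.Product using (_×_; _,_)
open import Data.Sum using (inj₁; inj₂)
import Algebra.Properties.Group as GroupProperties
import Algebra.Properties.CommutativeSemigroup as CommutativeSemigroupProperties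
import Relation.Binary.Reasoning.Setoid as SetoidReasoning

module _ {c ℓ p : Level} (G : AbelianGroup c ℓ) {S : Pred (AbelianGroup.Carrier G) p} where
  open AbelianGroup G
  open GroupProperties group using (∙-cancelˡ; ∙-cancelʳ)
  open CommutativeSemigroupProperties commutativeSemigroup using (interchange)
  open SetoidReasoning setoid

  xy∙zw≈xw∙zy : ∀ x y z w → (x ∙ y) ∙ (z ∙ w) ≈ (x ∙ w) ∙ (z ∙ y)
  xy∙zw≈xw∙zy x y z w = begin
    (x ∙ y) ∙ (z ∙ w) ≈⟨ interchange x y z w ⟩
    (x ∙ z) ∙ (y ∙ w) ≈⟨ ∙-congˡ (comm y w) ⟩
    (x ∙ z) ∙ (w ∙ y) ≈⟨ interchange x w z y ⟨
    (x ∙ w) ∙ (z ∙ y) ∎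

  Adj-sym : RespectsEq G S → ∀ {x y} → Adj G S x y → Adj G S y x
  Adj-sym resp {x} {y} = resp (comm x y)

  Sidon⇒¬C4 : RespectsEq G S → IsSidon G S → ¬ HasC4 G S
  Sidon⇒¬C4 resp sidon
    (x₁ , x₂ , x₃ , x₄ , (_ , x₁≉x₃ , _ , _ , x₂≉x₄ , _) , (e₁₂ , e₂₃ , e₃₄ , e₄₁))
    with sidon e₁₂ e₃₄ (Adj-sym resp e₄₁) (Adj-sym resp e₂₃) (xy∙zw≈xw∙zy x₁ x₂ x₃ x₄)
  ... | inj₁ x₁x₂≈x₁x₄ = x₂≉x₄ (∙-cancelˡ x₁ x₂ x₄ x₁x₂≈x₁x₄)
  ... | inj₂ x₁x₂≈x₃x₂ = x₁≉x₃ (∙-cancelʳ x₂ x₁ x₃ x₁x₂≈x₃x₂)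

  C4-sum≈center : ∀ {a₀ a₁ a₂ b b′} → IsPartialSymSidon G S a₀ →
                  ¬ a₁ ≈ a₂ → ¬ b ≈ b′ →
                  Adj G S a₁ b → Adj G S a₁ b′ → Adj G S a₂ b → Adj G S a₂ b′ →
                  (a₁ ∙ b) ∙ (a₂ ∙ b′) ≈ a₀
  C4-sum≈center {a₁ = a₁} {a₂} {b} {b′} (_ , sidon) a₁≉a₂ b≉b′ e₁ e₁′ e₂ e₂′
    with sidon e₁ e₂′ e₁′ e₂ (xy∙zw≈xw∙zy a₁ b a₂ b′)
  ... | inj₁ (inj₁ a₁b≈a₁b′) = contradiction (∙-cancelˡ a₁ b b′ a₁b≈a₁b′) b≉b′
  ... | inj₁ (inj₂ a₁b≈a₂b) = contradiction (∙-cancelʳ b a₁ a₂ a₁b≈a₂b) a₁≉a₂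
  ... | inj₂ (sum≈a₀ , _) = sum≈a₀

  PartialSymSidon⇒¬K23 : ∀ {a₀} → IsPartialSymSidon G S a₀ → ¬ HasK23 G S
  PartialSymSidon⇒¬K23 {a₀} sidon
    (a₁ , a₂ , b₁ , b₂ , b₃ ,
     (a₁≉a₂ , _ , _ , _ , _ , _ , _ , b₁≉b₂ , b₁≉b₃ , b₂≉b₃) ,
     (e₁₁ , e₁₂ , e₁₃ , e₂₁ , e₂₂ , e₂₃)) =
    b₂≉b₃ (∙-cancelˡ a₂ b₂ b₃ (∙-cancelˡ (a₁ ∙ b₁) (a₂ ∙ b₂) (a₂ ∙ b₃) (begin
      (a₁ ∙ b₁) ∙ (a₂ ∙ b₂) ≈⟨ C4-sum≈center sidon a₁≉a₂ b₁≉b₂ e₁₁ e₁₂ e₂₁ e₂₂ ⟩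
      a₀                    ≈⟨ C4-sum≈center sidon a₁≉a₂ b₁≉b₃ e₁₁ e₁₃ e₂₁ e₂₃ ⟨
      (a₁ ∙ b₁) ∙ (a₂ ∙ b₃) ∎)))

proposition3p1 : ∀ {c ℓ p : Level} (G : AbelianGroup c ℓ) (S : Pred (AbelianGroup.Carrier G) p)
                 → RespectsEq G S
                 → (IsSidon G S → ¬ HasC4 G S)
                   × (∀ a₀ → IsPartialSymSidon G S a₀ → ¬ HasK23 G S)
proposition3p1 G S resp = Sidon⇒¬C4 G resp , λ _ → PartialSymSidon⇒¬K23 G
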